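{- (1) $\mathbf{K_N^{Horn}}$ and $\mathbf{K_N^{Krom}}$ are $\preceq^w$-incomparable, i.e. neither $\mathbf{K_N^{Horn}}\preceq^w\mathbf{K_N^{Krom}}$ nor $\mathbf{K_N^{Krom}}\preceq^w\mathbf{K_N^{Horn}}$. (2) $\mathbf{K_N^{core}}\prec^w\mathbf{K_N^{Krom}}$ and $\mathbf{K_N^{core}}\prec^w\mathbf{K_N^{Horn}}$.
   Context: Fix a finite set $\tau=\{\alpha_1,\dots,\alpha_N\}$ of modality labels and a countable set $\mathcal P$ of propositional letters. Formulas of $\mathbf{K_N}$ are generated by $\varphi ::= \top \mid p \mid \neg\varphi \mid \varphi\vee\varphi \mid \Diamond_\alpha\varphi \mid \Box_\alpha\varphi$ ($p\in\mathcal P$, $\alpha\in\tau$); $\wedge,\rightarrow$ are abbreviations and $\bot=\neg\top$. Models $M=(W,\{R_\alpha\}_{\alpha\in\tau},V)$ with $W\neq\emptyset$, $R_\alpha\subseteq W\times W$, $V:W\to 2^{\mathcal P}$, with standard Kripke semantics $M,w\Vdash\varphi$. Positive literals: $\lambda ::= \top \mid p \mid \Diamond_\alpha\lambda \mid \Box_\alpha\lambda$. A formula is in clausal form if generated by $\varphi ::= \lambda \mid \neg\lambda \mid \nabla(\neg\lambda_1\vee\dots\vee\neg\lambda_n\vee\lambda_{n+1}\vee\dots\vee\lambda_{n+m}) \mid \varphi\wedge\varphi$, where the $\lambda,\lambda_i$ are positive literals and $\nabla$ is a finite (possibly empty) sequence of boxes. $\mathbf{K_N^{Horn}}$: every clause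 has $m\le1$; $\mathbf{K_N^{Krom}}$: every clause has $n+m\le2$; $\mathbf{K_N^{core}}$: both restrictions. Expressivity (over all Kripke frames): $\mathbf L\preceq^w\mathbf L'$ if, for a fixed alphabet $\mathcal P$, there is an effective translation $\varphi\mapsto\varphi'$ from $\mathbf L$-formulas over $\mathcal P$ to $\mathbf L'$-formulas over the same $\mathcal P$ with $M,w\Vdash\varphi$ iff $M,w\Vdash\varphi'$ for every model $M$ and world $w$. $\mathbf L\equiv^w\mathbf L'$ means both directions of $\preceq^w$ hold; $\mathbf L\prec^w\mathbf L'$ means $\mathbf L\preceq^w\mathbf L'$ and not $\mathbf L\equiv^w\mathbf L'$. -}

module Defs where

open import Data.Nat using (ℕ; _+_; _≤_)
open import Data.Fin using (Fin)
open import Data.List using (List; []; _∷_; length; map)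
open import Data.Product using (Σ; _×_; _,_)
open import Data.Sum using (_⊎_)
open import Data.Unit using (⊤)
open import Data.Empty using (⊥)
open import Relation.Nullary using (¬_)
open import Function.Bundles using (_⇔_)

-- Modality labels: τ = Fin N.  Propositional letters: 𝒫 = ℕ (countably infinite).

data Fml (N : ℕ) : Set where
  ⊤ᶠ  : Fml N
  var : ℕ → Fml N
  ¬ᶠ_ : Fml N → Fml N
  _∨ᶠ_ : Fml N → Fml N → Fml N
  ◇ᶠ  : Fin N → Fml N → Fml N
  □ᶠ  : Fin N → Fml N → Fml N

⊥ᶠ : ∀ {N} → Fml N
⊥ᶠ = ¬ᶠ ⊤ᶠ

_∧ᶠ_ : ∀ {N} → Fml N → Fml N → Fml N
φ ∧ᶠ ψ = ¬ᶠ ((¬ᶠ φ) ∨ᶠ (¬ᶠ ψ))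

record Model (N : ℕ) : Set₁ where
  field
    W : Set
    nonempty : W
    R : Fin N → W → W → Set
    V : W → ℕ → Set

open Model public

_,_⊩_ : ∀ {N} (M : Model N) → W M → Fml N → Set
M , w ⊩ ⊤ᶠ = ⊤
M , w ⊩ var p = V M w p
M , w ⊩ (¬ᶠ φ) = ¬ (M , w ⊩ φ)
M , w ⊩ (φ ∨ᶠ ψ) = (M , w ⊩ φ) ⊎ (M , w ⊩ ψ)
M , w ⊩ ◇ᶠ a φ = Σ (W M) (λ v → R M a w v × (M , v ⊩ φ))
M , w ⊩ □ᶠ a φ = (v : W M) → R M a w v → M , v ⊩ φ

data Lit (N : ℕ) : Set where
  ⊤ˡ  : Lit N
  varˡ : ℕ → Lit N
  ◇ˡ  : Fin N → Lit N → Lit N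
  □ˡ  : Fin N → Lit N → Lit N

⟦_⟧ˡ : ∀ {N} → Lit N → Fml N
⟦ ⊤ˡ ⟧ˡ = ⊤ᶠ
⟦ varˡ p ⟧ˡ = var p
⟦ ◇ˡ a l ⟧ˡ = ◇ᶠ a ⟦ l ⟧ˡ
⟦ □ˡ a l ⟧ˡ = □ᶠ a ⟦ l ⟧ˡ

-- Formulas in clausal form:
--   φ ::= λ | ¬λ | ∇(¬λ₁ ∨ … ∨ ¬λₙ ∨ λₙ₊₁ ∨ … ∨ λₙ₊ₘ) | φ ∧ φ
-- where ∇ is a finite (possibly empty) sequence of boxes (given by their labels).
data CF (N : ℕ) : Set where
  lit    : Lit N → CF N
  nlit   : Lit N → CF N
  clause : (∇ : List (Fin N)) (negs poss : List (Lit N)) → CF N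
  _∧ᶜ_   : CF N → CF N → CF N

⋁ : ∀ {N} → List (Fml N) → Fml N
⋁ [] = ⊥ᶠ
⋁ (φ ∷ []) = φ
⋁ (φ ∷ ψ ∷ φs) = φ ∨ᶠ ⋁ (ψ ∷ φs)

boxes : ∀ {N} → List (Fin N) → Fml N → Fml N
boxes [] φ = φ
boxes (a ∷ as) φ = □ᶠ a (boxes as φ)

⟦_⟧ : ∀ {N} → CF N → Fml N
⟦ lit l ⟧ = ⟦ l ⟧ˡ
⟦ nlit l ⟧ = ¬ᶠ ⟦ l ⟧ˡ
⟦ clause ∇ negs poss ⟧ =
  boxes ∇ (⋁ (map (λ l → ¬ᶠ ⟦ l ⟧ˡ) negs Data.List.++ map ⟦_⟧ˡ poss))
⟦ φ ∧ᶜ ψ ⟧ = ⟦ φ ⟧ ∧ᶠ ⟦ ψ ⟧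

Restr : ∀ {N} → (ℕ → ℕ → Set) → CF N → Set
Restr P (lit _) = P 0 1
Restr P (nlit _) = P 1 0
Restr P (clause _ negs poss) = P (length negs) (length poss)
Restr P (φ ∧ᶜ ψ) = Restr P φ × Restr P ψ

HornR KromR CoreR : ℕ → ℕ → Set
HornR n m = m ≤ 1
KromR n m = n + m ≤ 2
CoreR n m = (m ≤ 1) × (n + m ≤ 2)

Horn Krom Core : ∀ {N} → CF N → Set
Horn = Restr HornR
Krom = Restr KromR
Core = Restr CoreR

-- Expressivity over all Kripke models: an (effective = Agda-definable)
-- translation from L-formulas to L'-formulas over the same alphabet ℕ
-- preserving truth at every world of every model.
_⪯ʷ_ : ∀ {N} → (CF N → Set) → (CF N → Set) → Set₁
_⪯ʷ_ {N} L L' =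
  Σ ((φ : CF N) → L φ → CF N) λ tr →
    ((φ : CF N) (h : L φ) → L' (tr φ h)) ×
    ((φ : CF N) (h : L φ) (M : Model N) (w : W M) →
       (M , w ⊩ ⟦ φ ⟧) ⇔ (M , w ⊩ ⟦ tr φ h ⟧))

_≡ʷ_ : ∀ {N} → (CF N → Set) → (CF N → Set) → Set₁
L ≡ʷ L' = (L ⪯ʷ L') × (L' ⪯ʷ L)

_≺ʷ_ : ∀ {N} → (CF N → Set) → (CF N → Set) → Set₁
L ≺ʷ L' = (L ⪯ʷ L') × ¬ (L ≡ʷ L')

-- At a world without successors every □-literal is true and every ◇-literal false, so
-- on such one-point models a clausal formula is just a propositional formula whose
-- clauses are Horn, resp. Krom, clauses.  Propositional Horn clauses are preserved by
-- the pointwise conjunction of two valuations and Krom clauses by the pointwise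
-- majority of three.  Neither operation preserves the other kind of clause:
-- ¬p₀ ∨ ¬p₁ ∨ ¬p₂ holds under three valuations each falsifying a different pᵢ, but not
-- under their majority, and p₀ ∨ p₁ holds under the valuations {p₀} and {p₁} but not
-- under their conjunction.  Hence no truth-preserving translation exists in either
-- direction.  Core is a subfragment of both, so equivalence of Core with one of them
-- would make Horn and Krom comparable.
module Submission where

open import Defs
open import Data.Bool using (Bool; true; false; not; _∧_; _∨_; _≟_)
open import Data.Bool.Properties using (∧-zeroʳ; ∨-zeroʳ; ∧-idem; ∨-idem; ¬-not; not-¬)
open import Data.Empty using (⊥; ⊥-elim)
open import Data.Fin using (Fin; toℕ)
open import Data.Fin.Patterns using (0F; 1F; 2F)
open import Data.List using (List; []; _∷_; length; map; _++_; upTo)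
open import Data.List.Properties using (length-++; length-map)
open import Data.List.Relation.Unary.Any as Any using (Any; here; there)
open import Data.List.Relation.Unary.Any.Properties using (++⁻; ++⁺ˡ; ++⁺ʳ; map⁻; map⁺)
open import Data.Nat using (ℕ; _+_; _≤_; _≡ᵇ_; z≤n; s≤s)
open import Data.Product using (_×_; _,_; _,′_; proj₁; proj₂)
open import Data.Sum as Sum using (_⊎_; inj₁; inj₂)
open import Data.Unit using (tt) renaming (⊤ to Unit)
open import Function using (_∘_)
open import Function.Bundles using (_⇔_; mk⇔; Equivalence)
open import Function.Construct.Composition using (_⇔-∘_)
open import Function.Construct.Identity using (⇔-id)
open import Relation.Binary.PropositionalEquality using (_≡_; refl; sym; trans; cong; cong₂; subst)
open import Relation.Unary using (_∩_)
open import Relation.Nullary using (¬_; Dec; yes; no; ¬?; _⊎-dec_; decidable-stable)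

open Equivalence using (to; from)

Valuation : Set
Valuation = ℕ → Bool

Satisfies : {A : Set} → (A → Bool) → List A → List A → Set
Satisfies val negs poss = Any (λ x → val x ≡ false) negs ⊎ Any (λ x → val x ≡ true) poss

Satisfies-cong : {A : Set} {f g : A → Bool} → (∀ x → f x ≡ g x) →
                 ∀ negs poss → Satisfies f negs poss → Satisfies g negs poss
Satisfies-cong f≗g negs poss =
  Sum.map (Any.map (λ {x} → trans (sym (f≗g x)))) (Any.map (λ {x} → trans (sym (f≗g x))))

-- op preserves every clause whose shape (number of negative, positive literals) is allowed
-- by P; each x : A is a column of a k-row truth table.
Polymorphism : {k : ℕ} → (ℕ → ℕ → Set) → ((Fin k → Bool) → Bool) → Set₁
Polymorphism {k} P op =
  ∀ {A : Set} (val : Fin k → A → Bool) (negs poss : List A) → P (length negs) (length poss) →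
  (∀ i → Satisfies (val i) negs poss) → Satisfies (λ x → op (λ i → val i x)) negs poss

Idempotent : {k : ℕ} → ((Fin k → Bool) → Bool) → Set
Idempotent op = ∀ b → op (λ _ → b) ≡ b

pointwise : {k : ℕ} → ((Fin k → Bool) → Bool) → (Fin k → Valuation) → Valuation
pointwise op vs p = op (λ i → vs i p)

Any-∩-≤1 : {A : Set} {P Q : A → Set} (xs : List A) → length xs ≤ 1 →
              Any P xs → Any Q xs → Any (P ∩ Q) xs
Any-∩-≤1 (x ∷ []) _ (here p) (here q) = here (p , q)
Any-∩-≤1 (x ∷ []) _ _ (there ())
Any-∩-≤1 (x ∷ []) _ (there ()) _
Any-∩-≤1 (x ∷ y ∷ xs) (s≤s ()) _ _

Any-∩-≤2 : {A : Set} {P Q R : A → Set} (xs : List A) → length xs ≤ 2 →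
              Any P xs → Any Q xs → Any R xs →
              Any (P ∩ Q) xs ⊎ Any (Q ∩ R) xs ⊎ Any (P ∩ R) xs
Any-∩-≤2 (x ∷ xs) _ (here p) (here q) _ = inj₁ (here (p , q))
Any-∩-≤2 (x ∷ xs) _ _ (here q) (here r) = inj₂ (inj₁ (here (q , r)))
Any-∩-≤2 (x ∷ xs) _ (here p) _ (here r) = inj₂ (inj₂ (here (p , r)))
Any-∩-≤2 (x ∷ xs) (s≤s xs≤1) (there p) (there q) _ = inj₁ (there (Any-∩-≤1 xs xs≤1 p q))
Any-∩-≤2 (x ∷ xs) (s≤s xs≤1) _ (there q) (there r) = inj₂ (inj₁ (there (Any-∩-≤1 xs xs≤1 q r)))
Any-∩-≤2 (x ∷ xs) (s≤s xs≤1) (there p) _ (there r) = inj₂ (inj₂ (there (Any-∩-≤1 xs xs≤1 p r)))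

conj₂ : (Fin 2 → Bool) → Bool
conj₂ b = b 0F ∧ b 1F

conj₂-idempotent : Idempotent conj₂
conj₂-idempotent = ∧-idem

conj₂-Horn : Polymorphism HornR conj₂
conj₂-Horn val negs poss poss≤1 sat with sat 0F | sat 1F
... | inj₁ false₀ | _ =
  inj₁ (Any.map (λ {x} e → cong (_∧ val 1F x) e) false₀)
... | inj₂ _ | inj₁ false₁ =
  inj₁ (Any.map (λ {x} e → trans (cong (val 0F x ∧_) e) (∧-zeroʳ (val 0F x))) false₁)
... | inj₂ true₀ | inj₂ true₁ =
  inj₂ (Any.map (λ (e₀ , e₁) → cong₂ _∧_ e₀ e₁) (Any-∩-≤1 poss poss≤1 true₀ true₁))

maj : Bool → Bool → Bool → Bool
maj true y z = y ∨ z
maj false y z = y ∧ z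

maj-≡₀₁ : ∀ {x y z s} → x ≡ s → y ≡ s → maj x y z ≡ s
maj-≡₀₁ {s = true} refl refl = refl
maj-≡₀₁ {s = false} refl refl = refl

maj-≡₁₂ : ∀ {x y z s} → y ≡ s → z ≡ s → maj x y z ≡ s
maj-≡₁₂ {x = true} refl refl = ∨-idem _
maj-≡₁₂ {x = false} refl refl = ∧-idem _

maj-≡₀₂ : ∀ {x y z s} → x ≡ s → z ≡ s → maj x y z ≡ s
maj-≡₀₂ {y = y} {s = true} refl refl = ∨-zeroʳ y
maj-≡₀₂ {y = y} {s = false} refl refl = ∧-zeroʳ y

maj₃ : (Fin 3 → Bool) → Bool
maj₃ b = maj (b 0F) (b 1F) (b 2F)

maj₃-idempotent : Idempotent maj₃
maj₃-idempotent true = refl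
maj₃-idempotent false = refl

signed : {A : Set} → List A → List A → List (Bool × A)
signed negs poss = map (false ,′_) negs ++ map (true ,′_) poss

Agrees : {A : Set} → (A → Bool) → Bool × A → Set
Agrees val (s , x) = val x ≡ s

length-signed : {A : Set} (negs poss : List A) →
                length (signed negs poss) ≡ length negs + length poss
length-signed negs poss =
  trans (length-++ (map (false ,′_) negs))
        (cong₂ _+_ (length-map (false ,′_) negs) (length-map (true ,′_) poss))

Satisfies⇔Any-signed : {A : Set} (val : A → Bool) (negs poss : List A) →
                       Satisfies val negs poss ⇔ Any (Agrees val) (signed negs poss)
Satisfies⇔Any-signed val negs poss = mk⇔
  (Sum.[ ++⁺ˡ ∘ map⁺ , ++⁺ʳ (map (false ,′_) negs) ∘ map⁺ ]′)
  (Sum.map map⁻ map⁻ ∘ ++⁻ (map (false ,′_) negs))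

-- A Krom clause has at most two disjuncts, so two of the three valuations satisfy the
-- same one, and the majority agrees with them.
maj₃-Krom : Polymorphism KromR maj₃
maj₃-Krom {A} val negs poss n+m≤2 sat =
  from (Satisfies⇔Any-signed maj₃-val negs poss)
    (Sum.[ Any.map (λ (e₀ , e₁) → maj-≡₀₁ e₀ e₁)
         , Sum.[ Any.map (λ {(_ , x)} (e₁ , e₂) → maj-≡₁₂ {val 0F x} e₁ e₂)
               , Any.map (λ (e₀ , e₂) → maj-≡₀₂ e₀ e₂) ]′ ]′
      (Any-∩-≤2 (signed negs poss) (subst (_≤ 2) (sym (length-signed negs poss)) n+m≤2)
        (signed-sat 0F) (signed-sat 1F) (signed-sat 2F)))
  where
  maj₃-val : A → Bool
  maj₃-val x = maj₃ (λ i → val i x)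
  signed-sat : ∀ i → Any (Agrees (val i)) (signed negs poss)
  signed-sat i = to (Satisfies⇔Any-signed (val i) negs poss) (sat i)

module _ {N : ℕ} where

  pointModel : Valuation → Model N
  pointModel v = record { W = Unit ; nonempty = tt ; R = λ _ _ _ → ⊥ ; V = λ _ p → v p ≡ true }

  infix 4 _⊨_
  _⊨_ : Valuation → Fml N → Set
  v ⊨ φ = pointModel v , tt ⊩ φ

  ⊨-dec : ∀ v φ → Dec (v ⊨ φ)
  ⊨-dec v ⊤ᶠ = yes tt
  ⊨-dec v (var p) = v p ≟ true
  ⊨-dec v (¬ᶠ φ) = ¬? (⊨-dec v φ)
  ⊨-dec v (φ ∨ᶠ ψ) = ⊨-dec v φ ⊎-dec ⊨-dec v ψ
  ⊨-dec v (◇ᶠ a φ) = no λ ()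
  ⊨-dec v (□ᶠ a φ) = yes λ _ ()

  ⊨-∧ᶠ : ∀ {v} φ ψ → (v ⊨ φ ∧ᶠ ψ) ⇔ (v ⊨ φ × v ⊨ ψ)
  ⊨-∧ᶠ {v} φ ψ = mk⇔
    (λ φ∧ψ → decidable-stable (⊨-dec v φ) (φ∧ψ ∘ inj₁)
           , decidable-stable (⊨-dec v ψ) (φ∧ψ ∘ inj₂))
    (λ { (vφ , vψ) (inj₁ ¬vφ) → ¬vφ vφ ; (vφ , vψ) (inj₂ ¬vψ) → ¬vψ vψ })

  ⊨-⋁ : ∀ {v} φs → (v ⊨ ⋁ φs) ⇔ Any (v ⊨_) φs
  ⊨-⋁ φs = mk⇔ (to′ φs) (from′ φs)
    where
    to′ : ∀ {v} φs → v ⊨ ⋁ φs → Any (v ⊨_) φs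
    to′ [] ¬⊤ = ⊥-elim (¬⊤ tt)
    to′ (φ ∷ []) vφ = here vφ
    to′ (φ ∷ ψ ∷ φs) (inj₁ vφ) = here vφ
    to′ (φ ∷ ψ ∷ φs) (inj₂ vψs) = there (to′ (ψ ∷ φs) vψs)
    from′ : ∀ {v} φs → Any (v ⊨_) φs → v ⊨ ⋁ φs
    from′ (φ ∷ []) (here vφ) = vφ
    from′ (φ ∷ ψ ∷ φs) (here vφ) = inj₁ vφ
    from′ (φ ∷ ψ ∷ φs) (there vψs) = inj₂ (from′ (ψ ∷ φs) vψs)

  litVal : Valuation → Lit N → Bool
  litVal v ⊤ˡ = true
  litVal v (varˡ p) = v p
  litVal v (◇ˡ a l) = false
  litVal v (□ˡ a l) = true

  ⊨-lit : ∀ {v} l → (v ⊨ ⟦ l ⟧ˡ) ⇔ (litVal v l ≡ true)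
  ⊨-lit ⊤ˡ = mk⇔ (λ _ → refl) (λ _ → tt)
  ⊨-lit (varˡ p) = mk⇔ (λ e → e) (λ e → e)
  ⊨-lit (◇ˡ a l) = mk⇔ (λ { (_ , () , _) }) (λ ())
  ⊨-lit (□ˡ a l) = mk⇔ (λ _ → refl) (λ _ _ ())

  ⊨-¬lit : ∀ {v} l → (v ⊨ ¬ᶠ ⟦ l ⟧ˡ) ⇔ (litVal v l ≡ false)
  ⊨-¬lit ⊤ˡ = mk⇔ (λ ¬⊤ → ⊥-elim (¬⊤ tt)) (λ ())
  ⊨-¬lit (varˡ p) = mk⇔ ¬-not not-¬
  ⊨-¬lit (◇ˡ a l) = mk⇔ (λ _ → refl) (λ _ → λ { (_ , () , _) })
  ⊨-¬lit (□ˡ a l) = mk⇔ (λ ¬□ → ⊥-elim (¬□ (λ _ ()))) (λ ())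

  ⊨-clause : ∀ v negs poss → (v ⊨ ⟦ clause [] negs poss ⟧) ⇔ Satisfies (litVal v) negs poss
  ⊨-clause v negs poss = mk⇔
    (Sum.map neg→ pos→ ∘ ++⁻ (map ¬⟦_⟧ negs) ∘ to (⊨-⋁ disjuncts))
    (from (⊨-⋁ disjuncts) ∘ Sum.[ ++⁺ˡ ∘ neg← , ++⁺ʳ (map ¬⟦_⟧ negs) ∘ pos← ]′)
    where
    ¬⟦_⟧ : Lit N → Fml N
    ¬⟦ l ⟧ = ¬ᶠ ⟦ l ⟧ˡ
    disjuncts : List (Fml N)
    disjuncts = map ¬⟦_⟧ negs ++ map ⟦_⟧ˡ poss
    neg→ : Any (v ⊨_) (map ¬⟦_⟧ negs) → Any (λ l → litVal v l ≡ false) negs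
    neg→ = Any.map (λ {l} → to (⊨-¬lit l)) ∘ map⁻
    pos→ : Any (v ⊨_) (map ⟦_⟧ˡ poss) → Any (λ l → litVal v l ≡ true) poss
    pos→ = Any.map (λ {l} → to (⊨-lit l)) ∘ map⁻
    neg← : Any (λ l → litVal v l ≡ false) negs → Any (v ⊨_) (map ¬⟦_⟧ negs)
    neg← = map⁺ ∘ Any.map (λ {l} → from (⊨-¬lit l))
    pos← : Any (λ l → litVal v l ≡ true) poss → Any (v ⊨_) (map ⟦_⟧ˡ poss)
    pos← = map⁺ ∘ Any.map (λ {l} → from (⊨-lit l))

  module _ {k : ℕ} (op : (Fin k → Bool) → Bool) (idem : Idempotent op) where

    litVal-pointwise : ∀ vs l → litVal (pointwise op vs) l ≡ op (λ i → litVal (vs i) l)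
    litVal-pointwise vs ⊤ˡ = sym (idem true)
    litVal-pointwise vs (varˡ p) = refl
    litVal-pointwise vs (◇ˡ a l) = sym (idem false)
    litVal-pointwise vs (□ˡ a l) = sym (idem true)

    module _ (P : ℕ → ℕ → Set) (poly : Polymorphism P op) (vs : Fin k → Valuation) where

      clause-preserved : ∀ negs poss → P (length negs) (length poss) →
        (∀ i → vs i ⊨ ⟦ clause [] negs poss ⟧) → pointwise op vs ⊨ ⟦ clause [] negs poss ⟧
      clause-preserved negs poss shape sat =
        from (⊨-clause (pointwise op vs) negs poss)
          (Satisfies-cong (sym ∘ litVal-pointwise vs) negs poss
            (poly (λ i → litVal (vs i)) negs poss shape
                  (λ i → to (⊨-clause (vs i) negs poss) (sat i))))

      -- ⟦ lit l ⟧ and ⟦ nlit l ⟧ are definitionally one-literal clauses.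
      preserved : (φ : CF N) → Restr P φ → (∀ i → vs i ⊨ ⟦ φ ⟧) → pointwise op vs ⊨ ⟦ φ ⟧
      preserved (lit l) = clause-preserved [] (l ∷ [])
      preserved (nlit l) = clause-preserved (l ∷ []) []
      preserved (clause [] negs poss) = clause-preserved negs poss
      preserved (clause (a ∷ ∇) negs poss) _ _ _ ()
      preserved (φ ∧ᶜ ψ) (Pφ , Pψ) sat = from (⊨-∧ᶠ ⟦ φ ⟧ ⟦ ψ ⟧)
        ( preserved φ Pφ (proj₁ ∘ to (⊨-∧ᶠ ⟦ φ ⟧ ⟦ ψ ⟧) ∘ sat)
        , preserved ψ Pψ (proj₂ ∘ to (⊨-∧ᶠ ⟦ φ ⟧ ⟦ ψ ⟧) ∘ sat))

      ⋠ʷ-by-polymorphism : {L : CF N → Set} (φ : CF N) → L φ →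
        (∀ i → vs i ⊨ ⟦ φ ⟧) → ¬ (pointwise op vs ⊨ ⟦ φ ⟧) → ¬ (L ⪯ʷ Restr P)
      ⋠ʷ-by-polymorphism φ Lφ sat ¬sat (tr , tr-in , tr-sound) =
        ¬sat (from (tr-sound φ Lφ (pointModel (pointwise op vs)) tt)
          (preserved (tr φ Lφ) (tr-in φ Lφ)
            (λ i → to (tr-sound φ Lφ (pointModel (vs i)) tt) (sat i))))

  ⪯ʷ-trans : {L L′ L″ : CF N → Set} → L ⪯ʷ L′ → L′ ⪯ʷ L″ → L ⪯ʷ L″
  ⪯ʷ-trans (tr , tr-in , tr-sound) (tr′ , tr′-in , tr′-sound) =
    (λ φ Lφ → tr′ (tr φ Lφ) (tr-in φ Lφ)) ,
    (λ φ Lφ → tr′-in (tr φ Lφ) (tr-in φ Lφ)) ,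
    (λ φ Lφ M w → tr′-sound (tr φ Lφ) (tr-in φ Lφ) M w ⇔-∘ tr-sound φ Lφ M w)

  Restr-mono : {P Q : ℕ → ℕ → Set} → (∀ {n m} → P n m → Q n m) →
               (φ : CF N) → Restr P φ → Restr Q φ
  Restr-mono P⇒Q (lit l) = P⇒Q
  Restr-mono P⇒Q (nlit l) = P⇒Q
  Restr-mono P⇒Q (clause ∇ negs poss) = P⇒Q
  Restr-mono P⇒Q (φ ∧ᶜ ψ) (Pφ , Pψ) = Restr-mono P⇒Q φ Pφ , Restr-mono P⇒Q ψ Pψ

  ⪯ʷ-Restr : {P Q : ℕ → ℕ → Set} → (∀ {n m} → P n m → Q n m) → Restr P ⪯ʷ Restr Q
  ⪯ʷ-Restr P⇒Q = (λ φ _ → φ) , Restr-mono P⇒Q , (λ φ _ M w → ⇔-id (M , w ⊩ ⟦ φ ⟧))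

  vars : ℕ → List (Lit N)
  vars n = map varˡ (upTo n)

  ¬p₀∨¬p₁∨¬p₂ : CF N
  ¬p₀∨¬p₁∨¬p₂ = clause [] (vars 3) []

  p₀∨p₁ : CF N
  p₀∨p₁ = clause [] [] (vars 2)

  Horn⋠ʷKrom : ¬ (Horn {N} ⪯ʷ Krom)
  Horn⋠ʷKrom =
    ⋠ʷ-by-polymorphism maj₃ maj₃-idempotent KromR maj₃-Krom allBut ¬p₀∨¬p₁∨¬p₂ z≤n sat ¬sat
    where
    allBut : Fin 3 → Valuation
    allBut i p = not (toℕ i ≡ᵇ p)
    sat : ∀ i → allBut i ⊨ ⟦ ¬p₀∨¬p₁∨¬p₂ ⟧
    sat 0F = from (⊨-clause (allBut 0F) (vars 3) []) (inj₁ (here refl))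
    sat 1F = from (⊨-clause (allBut 1F) (vars 3) []) (inj₁ (there (here refl)))
    sat 2F = from (⊨-clause (allBut 2F) (vars 3) []) (inj₁ (there (there (here refl))))
    ¬sat : ¬ (pointwise maj₃ allBut ⊨ ⟦ ¬p₀∨¬p₁∨¬p₂ ⟧)
    ¬sat h with to (⊨-clause (pointwise maj₃ allBut) (vars 3) []) h
    ... | inj₁ (here ())
    ... | inj₁ (there (here ()))
    ... | inj₁ (there (there (here ())))
    ... | inj₂ ()

  Krom⋠ʷHorn : ¬ (Krom {N} ⪯ʷ Horn)
  Krom⋠ʷHorn =
    ⋠ʷ-by-polymorphism conj₂ conj₂-idempotent HornR conj₂-Horn only p₀∨p₁ (s≤s (s≤s z≤n)) sat ¬sat
    where
    only : Fin 2 → Valuation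
    only i p = toℕ i ≡ᵇ p
    sat : ∀ i → only i ⊨ ⟦ p₀∨p₁ ⟧
    sat 0F = from (⊨-clause (only 0F) [] (vars 2)) (inj₂ (here refl))
    sat 1F = from (⊨-clause (only 1F) [] (vars 2)) (inj₂ (there (here refl)))
    ¬sat : ¬ (pointwise conj₂ only ⊨ ⟦ p₀∨p₁ ⟧)
    ¬sat h with to (⊨-clause (pointwise conj₂ only) [] (vars 2)) h
    ... | inj₂ (here ())
    ... | inj₂ (there (here ()))

corollary1 : (N : ℕ) →
    (¬ (_⪯ʷ_ {N} Horn Krom) × ¬ (_⪯ʷ_ {N} Krom Horn)) ×
    (_≺ʷ_ {N} Core Krom × _≺ʷ_ {N} Core Horn)
corollary1 N =
  (Horn⋠ʷKrom , Krom⋠ʷHorn) ,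
  (Core⪯ʷKrom , λ (_ , Krom⪯ʷCore) → Krom⋠ʷHorn (⪯ʷ-trans {L″ = Horn} Krom⪯ʷCore Core⪯ʷHorn)) ,
  (Core⪯ʷHorn , λ (_ , Horn⪯ʷCore) → Horn⋠ʷKrom (⪯ʷ-trans {L″ = Krom} Horn⪯ʷCore Core⪯ʷKrom))
  where
  Core⪯ʷKrom : Core {N} ⪯ʷ Krom
  Core⪯ʷKrom = ⪯ʷ-Restr proj₂
  Core⪯ʷHorn : Core {N} ⪯ʷ Horn
  Core⪯ʷHorn = ⪯ʷ-Restr proj₁
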